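{- Let $\mathbf{u}=(u_1,\ldots,u_{n+1})$ belong to $\mathbf{Y}$. Then (i) if $u_1>0$ then $\mathbf{u}$ lies in the substructure of $\mathbf{Y}$ generated by $\{\mathbf{1},\ldots,\mathbf{n}\}$; (ii) if $u_1=0$ then $\mathbf{u}$ lies in the substructure generated by $\mathbf{n+1}$. Consequently, $\{\mathbf{1},\ldots,\mathbf{n+1}\}$ generates $\mathbf{Y}$.
   Context: $\mathbf{Z}_{2n+1}$ is the Sugihara algebra on $\{ -n,\ldots,n\}$ (lattice order, $\neg a=-a$, $a\to b=(-a)\vee b$ if $a\le b$, $(-a)\wedge b$ otherwise), with alter ego $\underset{\sim}{\mathbf{Z}}_{2n+1}=(\mathbf{Z}_{2n+1}; f_0,\ldots,f_n,g,\mathbf{0},\mathcal{T})$, where $f_0$ is the identity on $\mathbf{Z}_{2n+1}\setminus\{0\}$, $f_1$ the identity on $\mathbf{Z}_{2n+1}\setminus\{\pm1\}$, for $1<i\le n$ $f_i$ has domain $\mathbf{Z}_{2n+1}\setminus\{\pm i\}$, sends $i-1\mapsto i$, $-(i-1)\mapsto-i$, fixing other elements, $g(a)=a-1$ ($a>0$), $a+1$ ($a<0$), $g(0)=0$, and $\mathbf{0}$ the constant $0$; these generate all partial endomorphisms of $\mathbf{Z}_{2n+1}$. $\mathbf{Y}$ is the substructure of the power $\underset{\sim}{\mathbf{Z}}_{2n+1}^{\,n+1}$ (operations lifted coordinatewise) with universe $\{(a_1,\ldots,a_{n+1})\mid\exists j\ge1\,[\forall i\le j\ (0\le a_i=a_j)\text{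 and }\forall k\ge j\ (a_k<a_{k+1})]\}$. For $1\le k\le n$, $\mathbf{k}=(1,\ldots,1,2,\ldots,k)$ is the unique element of $\mathbf{Y}$ with coordinate set $\{1,\ldots,k\}$, and $\mathbf{n+1}=(0,1,\ldots,n)$. "Substructure generated" means closure under the lifted partial operations and constant. -}

module Defs where

import Data.Nat
open import Data.Nat using (ℕ; zero; suc; _∸_; _⊔_) renaming (_≤_ to _≤ℕ_)
open import Data.Integer using (ℤ; +_; -[1+_]; -_; _≤_; _<_; 0ℤ)
import Data.Integer as ℤ
open import Data.Fin using (Fin; toℕ; inject₁)
import Data.Fin
open import Data.Vec using (Vec; lookup; tabulate; map; head)
open import Data.Vec.Relation.Unary.All using (All)
open import Data.Product using (Σ; ∃; _×_)
open import Data.Sum using (_⊎_)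
open import Relation.Binary.PropositionalEquality using (_≡_; _≢_)
open import Relation.Nullary using (yes; no)

-- Elements of Z_{2n+1} are integers a with -n ≤ a ≤ n.
InZ : ℕ → ℤ → Set
InZ n a = (- (+ n)) ≤ a × a ≤ + n

-- Elements of the power Z_{2n+1}^{n+1}: vectors of length n+1
-- (coordinate u_c of the paper is  lookup u (c-1)).
Tuple : ℕ → Set
Tuple n = Vec ℤ (suc n)

FDom : ℕ → ℤ → Set
FDom zero    a = a ≢ 0ℤ
FDom (suc m) a = (a ≢ + suc m) × (a ≢ - (+ suc m))

f : ℕ → ℤ → ℤ
f zero a = a
f (suc zero) a = a
f (suc (suc m)) a with a ℤ.≟ + suc m
... | yes _ = + suc (suc m)
... | no _ with a ℤ.≟ - (+ suc m)
...   | yes _ = - (+ suc (suc m))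
...   | no _  = a

g : ℤ → ℤ
g (+ zero)    = + zero
g (+ suc m)   = + m
g -[1+ m ]    = - (+ m)

-- Substructure of the power generated by a set S of tuples:
-- closure under the constant 0 and the coordinatewise lifted
-- partial operations f_0,…,f_n (defined where every coordinate is in
-- the domain) and g.
data Gen (n : ℕ) (S : Tuple n → Set) : Tuple n → Set where
  gen  : ∀ {u} → S u → Gen n S u
  zer  : Gen n S (tabulate (λ _ → 0ℤ))
  fapp : ∀ {u} (i : ℕ) → i ≤ℕ n → Gen n S u → All (FDom i) u →
         Gen n S (map (f i) u)
  gapp : ∀ {u} → Gen n S u → Gen n S (map g u)

-- The universe of Y (with 0-based coordinate indices; j ranges over
-- Fin (suc n), corresponding to the paper's j+1 ≥ 1).
InY : (n : ℕ) → Tuple n → Set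
InY n u =
  All (InZ n) u ×
  Σ (Fin (suc n)) λ j →
    (∀ (i : Fin (suc n)) → toℕ i ≤ℕ toℕ j →
       (0ℤ ≤ lookup u i) × (lookup u i ≡ lookup u j)) ×
    (∀ (k : Fin n) → toℕ j ≤ℕ toℕ k →
       lookup u (inject₁ k) < lookup u (Data.Fin.suc k))

-- The element  k = (1,…,1,2,…,k)  for 1 ≤ k ≤ n: coordinate c (0-based)
-- is max(1, c + k - n).
elt : (n k : ℕ) → Tuple n
elt n k = tabulate (λ c → + (1 ⊔ (toℕ c Data.Nat.+ k ∸ n)))

eltTop : (n : ℕ) → Tuple n
eltTop n = tabulate (λ c → + toℕ c)

Low : (n : ℕ) → Tuple n → Set
Low n v = ∃ λ k → (1 ≤ℕ k) × (k ≤ℕ n) × (v ≡ elt n k)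

Top : (n : ℕ) → Tuple n → Set
Top n v = v ≡ eltTop n

AllGens : (n : ℕ) → Tuple n → Set
AllGens n v = Low n v ⊎ Top n v

-- Elements of Y have nonnegative coordinates, so each is the tuple of a
-- natural profile ψ (coordinate c ↦ ψ c), and Y consists exactly of the
-- tuples of profiles with a Shape: bounded by n, constant on [0, j] and
-- strictly increasing on [j, n] (shape⇒Y, Y⇒shape).  On profiles g acts as
-- pred and f_{m+2} moves the value m+1 to m+2.
--
-- Generation: iterating the f's moves a value x up to y when no coordinate
-- has a value in (x, y] (raise); hence moving the values m, m-1, …, 1 in
-- turn to φ m, …, φ 1, for φ increasing with φ r ≥ r, stays generated
-- (lift-generated).  A shaped ψ with ψ 0 = 0 is reached this way from the
-- staircase g^j (n+1) = (c ∸ j)_c, and one with ψ 0 ≥ 1 from the generator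
-- n ∸ (j - 1) (zero-generated, positive-generated, via reshape).
-- Closure: the generators and 0 are shaped, and shapes are preserved by
-- every fℕ i and by pred, so the generated substructure lies in Y.
module Submission where

open import Defs
open import Data.Nat using (ℕ)
open import Data.Integer using (0ℤ; _<_)
open import Data.Vec using (head)
open import Data.Product using (_×_)
open import Relation.Binary.PropositionalEquality using (_≡_)

open import Data.Nat as ℕ using (zero; suc; pred; _+_; _∸_; _⊔_; _≤_; _≤′_; z≤n; s≤s)
import Data.Nat.Properties as ℕₚ
open import Data.Integer as ℤ using (ℤ; +_; ∣_∣)
import Data.Integer.Properties as ℤₚ
open import Data.Fin using (Fin; toℕ; fromℕ<; inject₁)
import Data.Fin.Properties as Finₚ
open import Data.Vec using (Vec; []; _∷_; tabulate; map; lookup)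
open import Data.Vec.Properties using (tabulate-cong; tabulate-∘; lookup∘tabulate; tabulate∘lookup)
open import Data.Vec.Relation.Unary.All using (All)
open import Data.Vec.Relation.Unary.All.Properties using (lookup⁻; lookup⁺)
open import Data.Product using (Σ; _,_; proj₁; proj₂)
open import Data.Sum as Sum using (_⊎_; inj₁; inj₂)
open import Data.Empty using (⊥-elim)
open import Function using (_∘_)
open import Relation.Binary.PropositionalEquality using (_≢_; refl; sym; trans; cong; cong₂; subst; subst₂; module ≡-Reasoning)
open import Relation.Nullary using (yes; no)

-- A profile ψ : ℕ → ℕ describes the tuple (ψ 0, …, ψ n); only the
-- coordinates c ≤ n matter.  Elements of Y have nonnegative coordinates,
-- so the whole argument is carried out on profiles.
tuple : (n : ℕ) → (ℕ → ℕ) → Tuple n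
tuple n ψ = tabulate (λ c → + ψ (toℕ c))

lookup-tuple : ∀ {n} (ψ : ℕ → ℕ) (c : Fin (suc n)) → lookup (tuple n ψ) c ≡ + ψ (toℕ c)
lookup-tuple ψ = lookup∘tabulate (λ c → + ψ (toℕ c))

tuple-cong : ∀ {n} {ψ ψ′ : ℕ → ℕ} → (∀ c → c ≤ n → ψ c ≡ ψ′ c) → tuple n ψ ≡ tuple n ψ′
tuple-cong eq = tabulate-cong (λ c → cong +_ (eq (toℕ c) (Finₚ.toℕ≤pred[n] c)))

map-tuple : ∀ {n} {ψ ψ′ : ℕ → ℕ} (h : ℤ → ℤ) →
            (∀ c → c ≤ n → h (+ ψ c) ≡ + ψ′ c) → map h (tuple n ψ) ≡ tuple n ψ′
map-tuple {ψ = ψ} h eq =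
  trans (sym (tabulate-∘ h (λ c → + ψ (toℕ c))))
        (tabulate-cong (λ c → eq (toℕ c) (Finₚ.toℕ≤pred[n] c)))

all-tuple : ∀ {n} {P : ℤ → Set} {ψ : ℕ → ℕ} → (∀ c → c ≤ n → P (+ ψ c)) → All P (tuple n ψ)
all-tuple {P = P} {ψ} h =
  lookup⁻ (λ c → subst P (sym (lookup-tuple ψ c)) (h (toℕ c) (Finₚ.toℕ≤pred[n] c)))

tuple-all : ∀ {n} {P : ℤ → Set} {ψ : ℕ → ℕ} → All P (tuple n ψ) → ∀ c → c ≤ n → P (+ ψ c)
tuple-all {n} {P} {ψ} h c c≤n =
  subst P (trans (lookup-tuple ψ i) (cong (+_ ∘ ψ) (Finₚ.toℕ-fromℕ< (s≤s c≤n)))) (lookup⁺ h i)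
  where
  i : Fin (suc n)
  i = fromℕ< (s≤s c≤n)

replace : ℕ → ℕ → ℕ → ℕ
replace x y v with v ℕ.≟ x
... | yes _ = y
... | no _  = v

replace-cases : ∀ x y v → (v ≡ x × replace x y v ≡ y) ⊎ (v ≢ x × replace x y v ≡ v)
replace-cases x y v with v ℕ.≟ x
... | yes v≡x = inj₁ (v≡x , refl)
... | no v≢x  = inj₂ (v≢x , refl)

replace-miss : ∀ {x y v} → v ≢ x → replace x y v ≡ v
replace-miss {x} {y} {v} v≢x with replace-cases x y v
... | inj₁ (v≡x , _) = ⊥-elim (v≢x v≡x)
... | inj₂ (_ , eq)  = eq

replace-hit : ∀ {x y v} → v ≡ x → replace x y v ≡ y
replace-hit {x} {y} {v} v≡x with replace-cases x y v
... | inj₁ (_ , eq)   = eq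
... | inj₂ (v≢x , _) = ⊥-elim (v≢x v≡x)

replace-same : ∀ x v → replace x x v ≡ v
replace-same x v with replace-cases x x v
... | inj₁ (v≡x , eq) = trans eq (sym v≡x)
... | inj₂ (_ , eq)   = eq

module _ {x y v : ℕ} (x≤y : x ≤ y) (outside : v ≤ x ⊎ suc y ℕ.< v) where

  private
    far : v ≢ x → v ℕ.< y ⊎ suc y ℕ.< v
    far v≢x = Sum.map₁ (λ v≤x → ℕₚ.<-≤-trans (ℕₚ.≤∧≢⇒< v≤x v≢x) x≤y) outside

    far-≢ : ∀ {w} → v ℕ.< y ⊎ suc y ℕ.< v → y ≤ w → w ≤ suc y → v ≢ w
    far-≢ (inj₁ v<y)   y≤w _   refl = ℕₚ.<-irrefl refl (ℕₚ.<-≤-trans v<y y≤w)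
    far-≢ (inj₂ y+1<v) _   w≤y+1 refl = ℕₚ.<-irrefl refl (ℕₚ.≤-<-trans w≤y+1 y+1<v)

  replace-chain : replace y (suc y) (replace x y v) ≡ replace x (suc y) v
  replace-chain with replace-cases x y v
  ... | inj₁ (v≡x , eq) = trans (cong (replace y (suc y)) eq)
                                (trans (replace-hit {y} refl) (sym (replace-hit v≡x)))
  ... | inj₂ (v≢x , eq) = trans (cong (replace y (suc y)) eq)
                                (trans (replace-miss (far-≢ (far v≢x) ℕₚ.≤-refl (ℕₚ.n≤1+n y)))
                                       (sym (replace-miss v≢x)))

  replace-avoids : replace x y v ≢ suc y
  replace-avoids with replace-cases x y v
  ... | inj₁ (_ , eq)   = λ eq′ → ℕₚ.1+n≢n (sym (trans (sym eq) eq′))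
  ... | inj₂ (v≢x , eq) = λ eq′ → far-≢ (far v≢x) (ℕₚ.n≤1+n y) ℕₚ.≤-refl (trans (sym eq) eq′)

fℕ : ℕ → ℕ → ℕ
fℕ zero          a = a
fℕ (suc zero)    a = a
fℕ (suc (suc m)) a = replace (suc m) (suc (suc m)) a

f-on-ℕ : ∀ i {a} → FDom i (+ a) → f i (+ a) ≡ + fℕ i a
f-on-ℕ zero          _ = refl
f-on-ℕ (suc zero)    _ = refl
f-on-ℕ (suc (suc m)) {a} (+a≢m+2 , _) with + a ℤ.≟ + suc m | a ℕ.≟ suc m
... | yes _      | yes _    = refl
... | yes +a≡m+1 | no a≢m+1 = ⊥-elim (a≢m+1 (ℤₚ.+-injective +a≡m+1))
... | no +a≢m+1  | yes a≡m+1 = ⊥-elim (+a≢m+1 (cong +_ a≡m+1))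
... | no _       | no _ with + a ℤ.≟ ℤ.-[1+ suc m ]
...   | yes ()
...   | no _ = refl

g-on-ℕ : ∀ a → g (+ a) ≡ + pred a
g-on-ℕ zero    = refl
g-on-ℕ (suc a) = refl

Gen-mono : ∀ {n} {S S′ : Tuple n → Set} → (∀ {v} → S v → S′ v) → ∀ {u} → Gen n S u → Gen n S′ u
Gen-mono h (gen s)          = gen (h s)
Gen-mono h zer              = zer
Gen-mono h (fapp i i≤n G d) = fapp i i≤n (Gen-mono h G) d
Gen-mono h (gapp G)         = gapp (Gen-mono h G)

module Generation {n : ℕ} {S : Tuple n → Set} where

  Generated : (ℕ → ℕ) → Set
  Generated ψ = Gen n S (tuple n ψ)

  Generated-cong : ∀ {ψ ψ′} → (∀ c → c ≤ n → ψ c ≡ ψ′ c) → Generated ψ → Generated ψ′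
  Generated-cong eq = subst (Gen n S) (tuple-cong eq)

  f-step : ∀ {i ψ} → i ≤ n → (∀ c → c ≤ n → FDom i (+ ψ c)) → Generated ψ → Generated (fℕ i ∘ ψ)
  f-step {i} i≤n dom G =
    subst (Gen n S) (map-tuple (f i) (λ c c≤n → f-on-ℕ i (dom c c≤n))) (fapp i i≤n G (all-tuple dom))

  g-step : ∀ {ψ} → Generated ψ → Generated (pred ∘ ψ)
  g-step {ψ} G = subst (Gen n S) (map-tuple {ψ = ψ} g (λ c _ → g-on-ℕ (ψ c))) (gapp G)

  step-up : ∀ {x ψ} → 1 ≤ x → suc x ≤ n → (∀ c → c ≤ n → ψ c ≢ suc x) →
            Generated ψ → Generated (replace x (suc x) ∘ ψ)
  step-up {suc m} _ x<n free =
    f-step x<n (λ c c≤n → (λ eq → free c c≤n (ℤₚ.+-injective eq)) , λ ())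

  raise : ∀ {x y ψ} → 1 ≤ x → x ≤′ y → y ≤ n → (∀ c → c ≤ n → ψ c ≤ x ⊎ y ℕ.< ψ c) →
          Generated ψ → Generated (replace x y ∘ ψ)
  raise {x} {ψ = ψ} _ (ℕ.≤′-reflexive refl) _ _ G = Generated-cong (λ c _ → sym (replace-same x (ψ c))) G
  raise {x} {suc y} 1≤x (ℕ.≤′-step x≤′y) y<n gap G =
    Generated-cong (λ c c≤n → replace-chain x≤y (gap c c≤n))
      (step-up (ℕₚ.≤-trans 1≤x x≤y) y<n (λ c c≤n → replace-avoids x≤y (gap c c≤n))
        (raise 1≤x x≤′y (ℕₚ.<⇒≤ y<n) (λ c c≤n → Sum.map₂ ℕₚ.<⇒≤ (gap c c≤n)) G))
    where
    x≤y : x ≤ y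
    x≤y = ℕₚ.≤′⇒≤ x≤′y

lift : ℕ → (ℕ → ℕ) → ℕ → ℕ
lift zero    φ v = v
lift (suc m) φ v = lift m φ (replace (suc m) (φ (suc m)) v)

record Rising (n m : ℕ) (φ : ℕ → ℕ) : Set where
  field
    expanding  : ∀ {r} → 1 ≤ r → r ≤ m → r ≤ φ r
    bounded    : ∀ {r} → 1 ≤ r → r ≤ m → φ r ≤ n
    increasing : ∀ {r s} → 1 ≤ r → r ℕ.< s → s ≤ m → φ r ℕ.< φ s

Rising-pred : ∀ {n m φ} → Rising n (suc m) φ → Rising n m φ
Rising-pred R = record
  { expanding  = λ 1≤r r≤m → expanding 1≤r (ℕₚ.m≤n⇒m≤1+n r≤m)
  ; bounded    = λ 1≤r r≤m → bounded 1≤r (ℕₚ.m≤n⇒m≤1+n r≤m)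
  ; increasing = λ 1≤r r<s s≤m → increasing 1≤r r<s (ℕₚ.m≤n⇒m≤1+n s≤m)
  }
  where open Rising R

lift-fixes : ∀ m {φ v} → v ≡ 0 ⊎ m ℕ.< v → lift m φ v ≡ v
lift-fixes zero        _    = refl
lift-fixes (suc m) {φ} {v} away =
  trans (cong (lift m φ) (replace-miss v≢m+1)) (lift-fixes m (Sum.map₂ ℕₚ.<⇒≤ away))
  where
  v≢m+1 : v ≢ suc m
  v≢m+1 v≡m+1 = Sum.[ (λ v≡0 → ℕₚ.0≢1+n (trans (sym v≡0) v≡m+1))
                    , ℕₚ.<-irrefl (sym v≡m+1) ] away

lift-inside : ∀ {n m φ r} → Rising n m φ → 1 ≤ r → r ≤ m → lift m φ r ≡ φ r
lift-inside {m = zero} _ (s≤s _) ()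
lift-inside {m = suc m} {φ} {r} R 1≤r r≤m+1 with replace-cases (suc m) (φ (suc m)) r
... | inj₁ (refl , eq) = trans (cong (lift m φ) eq)
                               (lift-fixes m (inj₂ (Rising.expanding R 1≤r ℕₚ.≤-refl)))
... | inj₂ (r≢m+1 , eq) = trans (cong (lift m φ) eq)
                                (lift-inside (Rising-pred R) 1≤r (ℕₚ.≤-pred (ℕₚ.≤∧≢⇒< r≤m+1 r≢m+1)))

module Lifting {n : ℕ} {S : Tuple n → Set} where
  open Generation {n} {S}

  -- Lifting a generated profile gives a generated profile, provided every
  -- value above m is at least a bound T lying above all φ r: the raises are
  -- done from the top value down, so they never collide.
  lift-gen : ∀ {m φ T ψ} → Rising n m φ → (∀ {r} → 1 ≤ r → r ≤ m → φ r ℕ.< T) →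
             (∀ c → c ≤ n → ψ c ≤ m ⊎ T ≤ ψ c) → Generated ψ → Generated (lift m φ ∘ ψ)
  lift-gen {zero} _ _ _ G = G
  lift-gen {suc m} {φ} {T} {ψ} R below sep G =
    lift-gen (Rising-pred R) (λ 1≤r r≤m → increasing 1≤r (s≤s r≤m) ℕₚ.≤-refl) sep′
      (raise (s≤s z≤n) (ℕₚ.≤⇒≤′ (expanding (s≤s z≤n) ℕₚ.≤-refl)) (bounded (s≤s z≤n) ℕₚ.≤-refl)
             (λ c c≤n → Sum.map₂ (ℕₚ.<-≤-trans φm+1<T) (sep c c≤n)) G)
    where
    open Rising R
    φm+1<T : φ (suc m) ℕ.< T
    φm+1<T = below (s≤s z≤n) ℕₚ.≤-refl
    sep′ : ∀ c → c ≤ n → replace (suc m) (φ (suc m)) (ψ c) ≤ m ⊎ φ (suc m) ≤ replace (suc m) (φ (suc m)) (ψ c)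
    sep′ c c≤n with replace-cases (suc m) (φ (suc m)) (ψ c) | sep c c≤n
    ... | inj₁ (_ , eq)     | _            = inj₂ (ℕₚ.≤-reflexive (sym eq))
    ... | inj₂ (ψc≢m+1 , eq) | inj₁ ψc≤m+1 = inj₁ (subst (_≤ m) (sym eq) (ℕₚ.≤-pred (ℕₚ.≤∧≢⇒< ψc≤m+1 ψc≢m+1)))
    ... | inj₂ (_ , eq)     | inj₂ T≤ψc    = inj₂ (subst (φ (suc m) ≤_) (sym eq) (ℕₚ.<⇒≤ (ℕₚ.<-≤-trans φm+1<T T≤ψc)))

  lift-generated : ∀ {m φ ψ} → Rising n m φ → (∀ c → c ≤ n → ψ c ≤ m) → Generated ψ → Generated (lift m φ ∘ ψ)
  lift-generated R small = lift-gen R (λ 1≤r r≤m → s≤s (Rising.bounded R 1≤r r≤m)) (λ c c≤n → inj₁ (small c c≤n))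

record Shape (n : ℕ) (ψ : ℕ → ℕ) : Set where
  field
    j       : ℕ
    j≤n     : j ≤ n
    bounded : ∀ c → c ≤ n → ψ c ≤ n
    flat    : ∀ c → c ≤ j → ψ c ≡ ψ j
    rising  : ∀ k → j ≤ k → k ℕ.< n → ψ k ℕ.< ψ (suc k)

module ShapeProperties {n : ℕ} {ψ : ℕ → ℕ} (sh : Shape n ψ) where
  open Shape sh

  growth : ∀ a d → j ≤ a → a + d ≤ n → ψ a + d ≤ ψ (a + d)
  growth a zero    _   _ = ℕₚ.≤-reflexive (trans (ℕₚ.+-identityʳ (ψ a)) (cong ψ (sym (ℕₚ.+-identityʳ a))))
  growth a (suc d) j≤a a+d+1≤n = begin
    ψ a + suc d     ≡⟨ ℕₚ.+-suc (ψ a) d ⟩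
    suc (ψ a + d)   ≤⟨ s≤s (growth a d j≤a (ℕₚ.<⇒≤ a+d<n)) ⟩
    suc (ψ (a + d)) ≤⟨ rising (a + d) (ℕₚ.≤-trans j≤a (ℕₚ.m≤m+n a d)) a+d<n ⟩
    ψ (suc (a + d)) ≡⟨ cong ψ (sym (ℕₚ.+-suc a d)) ⟩
    ψ (a + suc d)   ∎
    where
    open ℕₚ.≤-Reasoning
    a+d<n : a + d ℕ.< n
    a+d<n = subst (_≤ n) (ℕₚ.+-suc a d) a+d+1≤n

  strict : ∀ {a b} → j ≤ a → a ℕ.< b → b ≤ n → ψ a ℕ.< ψ b
  strict {a} {b} j≤a a<b b≤n = begin-strict
    ψ a               <⟨ ℕₚ.m<m+n (ψ a) (ℕₚ.m<n⇒0<n∸m a<b) ⟩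
    ψ a + (b ∸ a)     ≤⟨ growth a (b ∸ a) j≤a (subst (_≤ n) (sym a+[b∸a]≡b) b≤n) ⟩
    ψ (a + (b ∸ a))   ≡⟨ cong ψ a+[b∸a]≡b ⟩
    ψ b               ∎
    where
    open ℕₚ.≤-Reasoning
    a+[b∸a]≡b : a + (b ∸ a) ≡ b
    a+[b∸a]≡b = ℕₚ.m+[n∸m]≡n (ℕₚ.<⇒≤ a<b)

  monotone : ∀ {a b} → j ≤ a → a ≤ b → b ≤ n → ψ a ≤ ψ b
  monotone j≤a a≤b b≤n with ℕₚ.m≤n⇒m<n∨m≡n a≤b
  ... | inj₁ a<b  = ℕₚ.<⇒≤ (strict j≤a a<b b≤n)
  ... | inj₂ refl = ℕₚ.≤-refl

  positive-start : 1 ≤ ψ 0 → 1 ≤ j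
  positive-start 1≤ψ0 = ℕₚ.n≢0⇒n>0 λ j≡0 → ℕₚ.<-irrefl refl (begin-strict
    n       <⟨ ℕₚ.n<1+n n ⟩
    1 + n   ≤⟨ ℕₚ.+-monoˡ-≤ n 1≤ψ0 ⟩
    ψ 0 + n ≤⟨ growth 0 n (ℕₚ.≤-reflexive j≡0) ℕₚ.≤-refl ⟩
    ψ n     ≤⟨ bounded n ℕₚ.≤-refl ⟩
    n       ∎)
    where open ℕₚ.≤-Reasoning

  offset-rising : ∀ o → o ≤ n → j ≤ suc o → (suc o ≤ n → 1 ≤ ψ (suc o)) →
                  Rising n (n ∸ o) (λ r → ψ (o + r))
  offset-rising o o≤n j≤o+1 starts = record
    { expanding  = expanding
    ; bounded    = λ _ r≤n∸o → bounded _ (fits r≤n∸o)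
    ; increasing = λ {r} 1≤r r<s s≤n∸o →
        strict (ℕₚ.≤-trans j≤o+1 (o+1≤o+r 1≤r)) (ℕₚ.+-monoʳ-< o r<s) (fits s≤n∸o)
    }
    where
    fits : ∀ {r} → r ≤ n ∸ o → o + r ≤ n
    fits r≤n∸o = ℕₚ.≤-trans (ℕₚ.+-monoʳ-≤ o r≤n∸o) (ℕₚ.≤-reflexive (ℕₚ.m+[n∸m]≡n o≤n))
    o+1≤o+r : ∀ {r} → 1 ≤ r → suc o ≤ o + r
    o+1≤o+r {r} 1≤r = subst (_≤ o + r) (ℕₚ.+-comm o 1) (ℕₚ.+-monoʳ-≤ o 1≤r)
    expanding : ∀ {r} → 1 ≤ r → r ≤ n ∸ o → r ≤ ψ (o + r)
    expanding {suc r} _ r+1≤n∸o = begin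
      suc r         ≤⟨ ℕₚ.+-monoˡ-≤ r (starts o+1≤n) ⟩
      ψ (suc o) + r ≤⟨ growth (suc o) r j≤o+1 (subst (_≤ n) (ℕₚ.+-suc o r) (fits r+1≤n∸o)) ⟩
      ψ (suc o + r) ≡⟨ cong ψ (sym (ℕₚ.+-suc o r)) ⟩
      ψ (o + suc r) ∎
      where
      open ℕₚ.≤-Reasoning
      o+1≤n : suc o ≤ n
      o+1≤n = ℕₚ.≤-trans (o+1≤o+r (s≤s z≤n)) (fits r+1≤n∸o)

  reshape : ∀ {S} o → o ≤ n → j ≤ suc o → (suc o ≤ n → 1 ≤ ψ (suc o)) → (b : ℕ → ℕ) →
            (∀ c → c ≤ n → b c ≤ n ∸ o) →
            (∀ c → c ≤ n → (b c ≡ 0 × ψ c ≡ 0) ⊎ (1 ≤ b c × ψ (o + b c) ≡ ψ c)) →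
            Gen n S (tuple n b) → Gen n S (tuple n ψ)
  reshape {S} o o≤n j≤o+1 starts b small meaning G =
    Generated-cong agree (lift-generated R small G)
    where
    open Generation {n} {S}
    open Lifting {n} {S}
    R : Rising n (n ∸ o) (λ r → ψ (o + r))
    R = offset-rising o o≤n j≤o+1 starts
    agree : ∀ c → c ≤ n → lift (n ∸ o) (λ r → ψ (o + r)) (b c) ≡ ψ c
    agree c c≤n with meaning c c≤n
    ... | inj₁ (bc≡0 , ψc≡0) = trans (lift-fixes (n ∸ o) (inj₁ bc≡0)) (trans bc≡0 (sym ψc≡0))
    ... | inj₂ (1≤bc , eq)   = trans (lift-inside R 1≤bc (small c c≤n)) eq

elt-tuple : ∀ {n k} → k ≤ n → elt n k ≡ tuple n (λ c → 1 ⊔ (c ∸ (n ∸ k)))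
elt-tuple {n} {k} k≤n = tuple-cong (λ c _ → cong (1 ⊔_) (begin
  c + k ∸ n             ≡⟨ cong₂ _∸_ (ℕₚ.+-comm c k) (sym (ℕₚ.m+[n∸m]≡n k≤n)) ⟩
  k + c ∸ (k + (n ∸ k)) ≡⟨ ℕₚ.[m+n]∸[m+o]≡n∸o k c (n ∸ k) ⟩
  c ∸ (n ∸ k)           ∎))
  where open ≡-Reasoning

offset-low : ∀ {o c} → c ≤ suc o → 1 ⊔ (c ∸ o) ≡ 1
offset-low {o} c≤o+1 =
  ℕₚ.m≥n⇒m⊔n≡m (ℕₚ.≤-trans (ℕₚ.∸-monoˡ-≤ o c≤o+1) (ℕₚ.≤-reflexive (ℕₚ.m+n∸n≡m 1 o)))

offset-high : ∀ {o c} → o ℕ.< c → 1 ⊔ (c ∸ o) ≡ c ∸ o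
offset-high o<c = ℕₚ.m≤n⇒m⊔n≡n (ℕₚ.m<n⇒0<n∸m o<c)

staircase : ∀ n t → Gen n (Top n) (tuple n (λ c → c ∸ t))
staircase n zero    = gen refl
staircase n (suc t) = Generated-cong (λ c _ → ℕₚ.pred[m∸n]≡m∸[1+n] c t) (g-step {ψ = λ c → c ∸ t} (staircase n t))
  where open Generation

-- (ii) A profile of shape with ψ 0 = 0 is generated by n+1: lift the
-- values r ≥ 1 of the staircase c ↦ c ∸ j to ψ (j + r).
zero-generated : ∀ {n ψ} → Shape n ψ → ψ 0 ≡ 0 → Gen n (Top n) (tuple n ψ)
zero-generated {n} {ψ} sh ψ0≡0 =
  reshape j j≤n (ℕₚ.n≤1+n j) starts (λ c → c ∸ j) (λ c c≤n → ℕₚ.∸-monoˡ-≤ j c≤n) meaning (staircase n j)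
  where
  open Shape sh
  open ShapeProperties sh
  starts : suc j ≤ n → 1 ≤ ψ (suc j)
  starts j<n = ℕₚ.≤-trans (s≤s z≤n) (rising j ℕₚ.≤-refl j<n)
  meaning : ∀ c → c ≤ n → (c ∸ j ≡ 0 × ψ c ≡ 0) ⊎ (1 ≤ c ∸ j × ψ (j + (c ∸ j)) ≡ ψ c)
  meaning c _ with c ℕ.≤? j
  ... | yes c≤j = inj₁ (ℕₚ.m≤n⇒m∸n≡0 c≤j , trans (flat c c≤j) (trans (sym (flat 0 z≤n)) ψ0≡0))
  ... | no c≰j  = inj₂ (ℕₚ.m<n⇒0<n∸m j<c , cong ψ (ℕₚ.m+[n∸m]≡n (ℕₚ.<⇒≤ j<c)))
    where
    j<c : j ℕ.< c
    j<c = ℕₚ.≰⇒> c≰j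

-- (i) A profile of shape with ψ 0 ≥ 1 is generated by 1, …, n: then
-- j = o + 1 ≥ 1, and the values r ≥ 1 of the generator n ∸ o, with profile
-- c ↦ 1 ⊔ (c ∸ o), lift to ψ (o + r).
positive-generated : ∀ {n ψ} → Shape n ψ → 1 ≤ ψ 0 → Gen n (Low n) (tuple n ψ)
positive-generated {n} {ψ} sh 1≤ψ0 =
  reshape o o≤n (ℕₚ.≤-reflexive (sym o+1≡j)) (λ _ → ψ[o+1]≥1) (λ c → 1 ⊔ (c ∸ o))
    (λ c c≤n → ℕₚ.⊔-lub 1≤n∸o (ℕₚ.∸-monoˡ-≤ o c≤n))
    (λ c _ → inj₂ (ℕₚ.m≤m⊔n 1 (c ∸ o) , meaning c))
    (Generated-cong (λ c _ → cong (λ p → 1 ⊔ (c ∸ p)) (ℕₚ.m∸[m∸n]≡n o≤n))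
      (subst (Gen n (Low n)) (elt-tuple (ℕₚ.m∸n≤m n o)) (gen (n ∸ o , 1≤n∸o , ℕₚ.m∸n≤m n o , refl))))
  where
  open Shape sh
  open ShapeProperties sh
  open Generation
  o : ℕ
  o = pred j
  o+1≡j : suc o ≡ j
  o+1≡j = ℕₚ.suc-pred j ⦃ ℕ.>-nonZero (positive-start 1≤ψ0) ⦄
  o<n : o ℕ.< n
  o<n = subst (_≤ n) (sym o+1≡j) j≤n
  o≤n : o ≤ n
  o≤n = ℕₚ.<⇒≤ o<n
  1≤n∸o : 1 ≤ n ∸ o
  1≤n∸o = ℕₚ.m<n⇒0<n∸m o<n
  ψ[o+1]≥1 : 1 ≤ ψ (suc o)
  ψ[o+1]≥1 = subst (1 ≤_) (trans (flat 0 z≤n) (cong ψ (sym o+1≡j))) 1≤ψ0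
  meaning : ∀ c → ψ (o + (1 ⊔ (c ∸ o))) ≡ ψ c
  meaning c with c ℕ.≤? j
  ... | yes c≤j = begin
    ψ (o + (1 ⊔ (c ∸ o))) ≡⟨ cong (λ r → ψ (o + r)) (offset-low (subst (c ≤_) (sym o+1≡j) c≤j)) ⟩
    ψ (o + 1)             ≡⟨ cong ψ (trans (ℕₚ.+-comm o 1) o+1≡j) ⟩
    ψ j                   ≡⟨ sym (flat c c≤j) ⟩
    ψ c                   ∎
    where open ≡-Reasoning
  ... | no c≰j = cong ψ (trans (cong (_+_ o) (offset-high o<c)) (ℕₚ.m+[n∸m]≡n (ℕₚ.<⇒≤ o<c)))
    where
    o<c : o ℕ.< c
    o<c = subst (_≤ c) (sym o+1≡j) (ℕₚ.<⇒≤ (ℕₚ.≰⇒> c≰j))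

-- The c-th entry of a vector as a total function of c (0 beyond the end).
entry : ∀ {m} → Vec ℤ m → ℕ → ℤ
entry []       _       = 0ℤ
entry (x ∷ xs) zero    = x
entry (x ∷ xs) (suc c) = entry xs c

entry-lookup : ∀ {m} (xs : Vec ℤ m) (i : Fin m) → entry xs (toℕ i) ≡ lookup xs i
entry-lookup (x ∷ xs) Fin.zero    = refl
entry-lookup (x ∷ xs) (Fin.suc i) = entry-lookup xs i

shape⇒Y : ∀ {n ψ} → Shape n ψ → InY n (tuple n ψ)
shape⇒Y {n} {ψ} sh = all-tuple (λ c c≤n → ℤₚ.neg-≤-pos , ℤ.+≤+ (bounded c c≤n)) , jF , flat-Fin , rising-Fin
  where
  open Shape sh
  jF : Fin (suc n)
  jF = fromℕ< (s≤s j≤n)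
  toℕjF≡j : toℕ jF ≡ j
  toℕjF≡j = Finₚ.toℕ-fromℕ< (s≤s j≤n)
  flat-Fin : ∀ i → toℕ i ≤ toℕ jF → (0ℤ ℤ.≤ lookup (tuple n ψ) i) × (lookup (tuple n ψ) i ≡ lookup (tuple n ψ) jF)
  flat-Fin i i≤j = subst (0ℤ ℤ.≤_) (sym (lookup-tuple ψ i)) (ℤ.+≤+ z≤n) , (begin
    lookup (tuple n ψ) i  ≡⟨ lookup-tuple ψ i ⟩
    + ψ (toℕ i)           ≡⟨ cong +_ (flat (toℕ i) (subst (toℕ i ≤_) toℕjF≡j i≤j)) ⟩
    + ψ j                 ≡⟨ cong (+_ ∘ ψ) (sym toℕjF≡j) ⟩
    + ψ (toℕ jF)          ≡⟨ sym (lookup-tuple ψ jF) ⟩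
    lookup (tuple n ψ) jF ∎)
    where open ≡-Reasoning
  rising-Fin : ∀ k → toℕ jF ≤ toℕ k → lookup (tuple n ψ) (inject₁ k) ℤ.< lookup (tuple n ψ) (Fin.suc k)
  rising-Fin k j≤k = subst₂ ℤ._<_
    (sym (trans (lookup-tuple ψ (inject₁ k)) (cong (+_ ∘ ψ) (Finₚ.toℕ-inject₁ k))))
    (sym (lookup-tuple ψ (Fin.suc k)))
    (ℤ.+<+ (rising (toℕ k) (subst (_≤ toℕ k) toℕjF≡j j≤k) (Finₚ.toℕ<n k)))

-- Conversely, every element of Y is the tuple of a shaped profile, namely
-- c ↦ ∣ u_c ∣: its entries are nonnegative, being so on the flat part and
-- increasing beyond it.
Y⇒shape : ∀ {n u} → InY n u → Σ (ℕ → ℕ) λ ψ → u ≡ tuple n ψ × Shape n ψ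
Y⇒shape {n} {u} (inZ , jF , flat-Fin , rising-Fin) =
  ψ , u≡tuple , record
    { j       = j
    ; j≤n     = Finₚ.toℕ≤pred[n] jF
    ; bounded = λ c c≤n → ℤₚ.drop‿+≤+ (proj₂ (tuple-all {ψ = ψ} (subst (All (InZ n)) u≡tuple inZ) c c≤n))
    ; flat    = λ c c≤j → cong ∣_∣ (proj₂ (flat-ℤ c c≤j))
    ; rising  = λ k j≤k k<n → ℤₚ.drop‿+<+
        (subst₂ ℤ._<_ (sym (+ψ k (ℕₚ.<⇒≤ k<n))) (sym (+ψ (suc k) k<n)) (rising-ℤ k j≤k k<n))
    }
  where
  j : ℕ
  j = toℕ jF
  at : ∀ {c} (c≤n : c ≤ n) → entry u c ≡ lookup u (fromℕ< (s≤s c≤n))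
  at c≤n = trans (cong (entry u) (sym (Finₚ.toℕ-fromℕ< (s≤s c≤n)))) (entry-lookup u _)
  flat-ℤ : ∀ c → c ≤ j → (0ℤ ℤ.≤ entry u c) × (entry u c ≡ entry u j)
  flat-ℤ c c≤j = subst (0ℤ ℤ.≤_) (sym (at c≤n)) 0≤ , trans (at c≤n) (trans eq (sym (entry-lookup u jF)))
    where
    c≤n : c ≤ n
    c≤n = ℕₚ.≤-trans c≤j (Finₚ.toℕ≤pred[n] jF)
    fact : (0ℤ ℤ.≤ lookup u (fromℕ< (s≤s c≤n))) × (lookup u (fromℕ< (s≤s c≤n)) ≡ lookup u jF)
    fact = flat-Fin (fromℕ< (s≤s c≤n)) (subst (_≤ j) (sym (Finₚ.toℕ-fromℕ< (s≤s c≤n))) c≤j)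
    0≤ : 0ℤ ℤ.≤ lookup u (fromℕ< (s≤s c≤n))
    0≤ = proj₁ fact
    eq : lookup u (fromℕ< (s≤s c≤n)) ≡ lookup u jF
    eq = proj₂ fact
  rising-ℤ : ∀ k → j ≤ k → k ℕ.< n → entry u k ℤ.< entry u (suc k)
  rising-ℤ k j≤k k<n = subst₂ ℤ._<_
    (sym (trans (cong (entry u) (sym (trans (Finₚ.toℕ-inject₁ kF) toℕkF≡k))) (entry-lookup u (inject₁ kF))))
    (sym (trans (cong (entry u ∘ suc) (sym toℕkF≡k)) (entry-lookup u (Fin.suc kF))))
    (rising-Fin kF (subst (j ≤_) (sym toℕkF≡k) j≤k))
    where
    kF : Fin n
    kF = fromℕ< k<n
    toℕkF≡k : toℕ kF ≡ k
    toℕkF≡k = Finₚ.toℕ-fromℕ< k<n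
  nonneg : ∀ c → c ≤ n → 0ℤ ℤ.≤ entry u c
  nonneg zero    _ = proj₁ (flat-ℤ 0 z≤n)
  nonneg (suc k) k<n with suc k ℕ.≤? j
  ... | yes k+1≤j = proj₁ (flat-ℤ (suc k) k+1≤j)
  ... | no k+1≰j  = ℤₚ.≤-trans (nonneg k (ℕₚ.<⇒≤ k<n)) (ℤₚ.<⇒≤ (rising-ℤ k (ℕₚ.≤-pred (ℕₚ.≰⇒> k+1≰j)) k<n))
  ψ : ℕ → ℕ
  ψ c = ∣ entry u c ∣
  +ψ : ∀ c → c ≤ n → + ψ c ≡ entry u c
  +ψ c c≤n = ℤₚ.0≤i⇒+∣i∣≡i (nonneg c c≤n)
  u≡tuple : u ≡ tuple n ψ
  u≡tuple = sym (trans (tabulate-cong (λ i → trans (+ψ (toℕ i) (Finₚ.toℕ≤pred[n] i)) (entry-lookup u i)))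
                       (tabulate∘lookup u))

top-shape : ∀ {n} → Shape n (λ c → c)
top-shape = record
  { j = 0 ; j≤n = z≤n ; bounded = λ _ c≤n → c≤n
  ; flat = λ c c≤0 → ℕₚ.n≤0⇒n≡0 c≤0 ; rising = λ k _ _ → ℕₚ.n<1+n k }

zero-shape : ∀ {n} → Shape n (λ _ → 0)
zero-shape {n} = record
  { j = n ; j≤n = ℕₚ.≤-refl ; bounded = λ _ _ → z≤n
  ; flat = λ _ _ → refl ; rising = λ k n≤k k<n → ⊥-elim (ℕₚ.<⇒≱ k<n n≤k) }

offset-shape : ∀ {n o} → o ℕ.< n → Shape n (λ c → 1 ⊔ (c ∸ o))
offset-shape {n} {o} o<n = record
  { j       = suc o
  ; j≤n     = o<n
  ; bounded = λ c c≤n → ℕₚ.⊔-lub (ℕₚ.≤-trans (s≤s z≤n) o<n) (ℕₚ.≤-trans (ℕₚ.m∸n≤m c o) c≤n)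
  ; flat    = λ c c≤o+1 → trans (offset-low c≤o+1) (sym (offset-low {o} ℕₚ.≤-refl))
  ; rising  = λ k o<k _ → begin-strict
      1 ⊔ (k ∸ o)       ≡⟨ offset-high o<k ⟩
      k ∸ o             <⟨ ℕₚ.n<1+n (k ∸ o) ⟩
      suc (k ∸ o)       ≡⟨ sym (ℕₚ.+-∸-assoc 1 (ℕₚ.<⇒≤ o<k)) ⟩
      suc k ∸ o         ≡⟨ sym (offset-high (ℕₚ.m<n⇒m<1+n o<k)) ⟩
      1 ⊔ (suc k ∸ o)   ∎
  }
  where open ℕₚ.≤-Reasoning

fℕ-bounded : ∀ {n} i {a} → i ≤ n → a ≤ n → fℕ i a ≤ n
fℕ-bounded zero          _ a≤n = a≤n
fℕ-bounded (suc zero)    _ a≤n = a≤n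
fℕ-bounded (suc (suc m)) {a} i≤n a≤n with replace-cases (suc m) (suc (suc m)) a
... | inj₁ (_ , eq) = subst (_≤ _) (sym eq) i≤n
... | inj₂ (_ , eq) = subst (_≤ _) (sym eq) a≤n

fℕ-strict : ∀ i {a b} → FDom i (+ b) → a ℕ.< b → fℕ i a ℕ.< fℕ i b
fℕ-strict zero          _ a<b = a<b
fℕ-strict (suc zero)    _ a<b = a<b
fℕ-strict (suc (suc m)) {a} {b} (b≢m+2 , _) a<b
  with replace-cases (suc m) (suc (suc m)) a | replace-cases (suc m) (suc (suc m)) b
... | inj₁ (refl , _)   | inj₁ (refl , _)   = ⊥-elim (ℕₚ.<-irrefl refl a<b)
... | inj₁ (refl , eqa) | inj₂ (b≢m+1 , eqb) =
  subst₂ ℕ._<_ (sym eqa) (sym eqb) (ℕₚ.≤∧≢⇒< a<b (λ m+2≡b → b≢m+2 (cong +_ (sym m+2≡b))))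
... | inj₂ (_ , eqa)    | inj₁ (refl , eqb) = subst₂ ℕ._<_ (sym eqa) (sym eqb) (ℕₚ.m<n⇒m<1+n a<b)
... | inj₂ (_ , eqa)    | inj₂ (_ , eqb)    = subst₂ ℕ._<_ (sym eqa) (sym eqb) a<b

shape-f : ∀ {n ψ i} → i ≤ n → (∀ c → c ≤ n → FDom i (+ ψ c)) → Shape n ψ → Shape n (fℕ i ∘ ψ)
shape-f {i = i} i≤n dom sh = record
  { j = j ; j≤n = j≤n
  ; bounded = λ c c≤n → fℕ-bounded i i≤n (bounded c c≤n)
  ; flat    = λ c c≤j → cong (fℕ i) (flat c c≤j)
  ; rising  = λ k j≤k k<n → fℕ-strict i (dom (suc k) k<n) (rising k j≤k k<n)
  }
  where open Shape sh

pred-strict : ∀ {a b} → a ℕ.< b → 2 ≤ b → pred a ℕ.< pred b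
pred-strict {b = suc zero}    _   (s≤s ())
pred-strict {b = suc (suc _)} a<b _ = s≤s (ℕₚ.pred-mono-≤ (ℕₚ.≤-pred a<b))

module _ {n : ℕ} {ψ : ℕ → ℕ} (sh : Shape n ψ) where
  open Shape sh
  open ShapeProperties sh

  private
    pred-bounded : ∀ c → c ≤ n → pred (ψ c) ≤ n
    pred-bounded c c≤n = ℕₚ.≤-trans ℕₚ.pred[n]≤n (bounded c c≤n)

    -- if the first increasing step ends at a value ≥ 2, j stays put
    pred-same : (j ℕ.< n → 2 ≤ ψ (suc j)) → Shape n (pred ∘ ψ)
    pred-same steep = record
      { j = j ; j≤n = j≤n ; bounded = pred-bounded
      ; flat    = λ c c≤j → cong pred (flat c c≤j)
      ; rising  = λ k j≤k k<n → pred-strict (rising k j≤k k<n)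
          (ℕₚ.≤-trans (steep (ℕₚ.≤-<-trans j≤k k<n)) (monotone (ℕₚ.n≤1+n j) (s≤s j≤k) k<n))
      }

    -- if it goes from 0 to 1, the flat part grows by one coordinate
    pred-shifted : j ℕ.< n → ψ (suc j) ≡ 1 → Shape n (pred ∘ ψ)
    pred-shifted j<n ψ[j+1]≡1 = record
      { j = suc j ; j≤n = j<n ; bounded = pred-bounded
      ; flat    = λ c c≤j+1 → trans (vanish c c≤j+1) (sym (vanish (suc j) ℕₚ.≤-refl))
      ; rising  = λ k j<k k<n → pred-strict (rising k (ℕₚ.<⇒≤ j<k) k<n)
          (subst (ℕ._< ψ (suc k)) ψ[j+1]≡1 (strict (ℕₚ.n≤1+n j) (s≤s j<k) k<n))
      }
      where
      vanish : ∀ c → c ≤ suc j → pred (ψ c) ≡ 0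
      vanish c c≤j+1 = ℕₚ.n≤0⇒n≡0 (ℕₚ.pred-mono-≤ (subst (ψ c ≤_) ψ[j+1]≡1 ψc≤ψ[j+1]))
        where
        ψc≤ψ[j+1] : ψ c ≤ ψ (suc j)
        ψc≤ψ[j+1] with ℕₚ.m≤n⇒m<n∨m≡n c≤j+1
        ... | inj₁ c<j+1 = ℕₚ.<⇒≤ (subst (ℕ._< ψ (suc j)) (sym (flat c (ℕₚ.≤-pred c<j+1))) (rising j ℕₚ.≤-refl j<n))
        ... | inj₂ refl  = ℕₚ.≤-refl

  shape-pred : Shape n (pred ∘ ψ)
  shape-pred with j ℕ.<? n
  ... | no j≮n = pred-same (λ j<n → ⊥-elim (j≮n j<n))
  ... | yes j<n with ψ (suc j) ℕ.≟ 1
  ...   | yes ψ[j+1]≡1 = pred-shifted j<n ψ[j+1]≡1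
  ...   | no ψ[j+1]≢1  = pred-same (λ _ → ℕₚ.≤∧≢⇒< (ℕₚ.≤-trans (s≤s z≤n) (rising j ℕₚ.≤-refl j<n)) (ψ[j+1]≢1 ∘ sym))

Y-closed-f : ∀ {n u i} → i ≤ n → InY n u → All (FDom i) u → InY n (map (f i) u)
Y-closed-f {n} {i = i} i≤n y d with Y⇒shape y
... | ψ , refl , sh =
  subst (InY n) (sym (map-tuple (f i) (λ c c≤n → f-on-ℕ i (dom c c≤n)))) (shape⇒Y (shape-f i≤n dom sh))
  where
  dom : ∀ c → c ≤ n → FDom i (+ ψ c)
  dom = tuple-all d

Y-closed-g : ∀ {n u} → InY n u → InY n (map g u)
Y-closed-g {n} y with Y⇒shape y
... | ψ , refl , sh = subst (InY n) (sym (map-tuple {ψ = ψ} g (λ c _ → g-on-ℕ (ψ c)))) (shape⇒Y (shape-pred sh))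

closure : ∀ {n u} → Gen n (AllGens n) u → InY n u
closure {n} (gen (inj₁ (k , 1≤k , k≤n , refl))) =
  subst (InY n) (sym (elt-tuple k≤n)) (shape⇒Y (offset-shape (ℕₚ.∸-monoʳ-< 1≤k k≤n)))
closure (gen (inj₂ refl))     = shape⇒Y top-shape
closure zer                   = shape⇒Y zero-shape
closure (fapp i i≤n G d)      = Y-closed-f i≤n (closure G) d
closure (gapp G)              = Y-closed-g (closure G)

lemma5p3 : (n : ℕ) →
    (∀ (u : Tuple n) → InY n u →
        (0ℤ < head u → Gen n (Low n) u) ×
        (head u ≡ 0ℤ → Gen n (Top n) u)) ×
    (∀ (u : Tuple n) → InY n u → Gen n (AllGens n) u) ×
    (∀ (u : Tuple n) → Gen n (AllGens n) u → InY n u)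
lemma5p3 n = parts , generated , λ _ → closure
  where
  parts : ∀ u → InY n u → (0ℤ < head u → Gen n (Low n) u) × (head u ≡ 0ℤ → Gen n (Top n) u)
  parts u y with Y⇒shape y
  ... | ψ , refl , sh = (λ 0<ψ0 → positive-generated sh (ℤₚ.drop‿+<+ 0<ψ0))
                      , (λ ψ0≡0 → zero-generated sh (ℤₚ.+-injective ψ0≡0))
  generated : ∀ u → InY n u → Gen n (AllGens n) u
  generated u y with Y⇒shape y
  ... | ψ , refl , sh with ψ 0 ℕ.≟ 0
  ...   | yes ψ0≡0 = Gen-mono inj₂ (zero-generated sh ψ0≡0)
  ...   | no ψ0≢0  = Gen-mono inj₁ (positive-generated sh (ℕₚ.n≢0⇒n>0 ψ0≢0))
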